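{- Let $D=(V_1,V_2;A)$ be a split digraph such that $D[V_2]$ is not strong, and let $C_1,\ldots,C_p$ ($p\ge 2$) be the acyclic ordering of the strong components of $D[V_2]$. Let $C$ be a (multi)set of arcs with both endpoints in $V_2$, and suppose the multi-digraph $D[V_2]+C$ has two arc-disjoint $(V(C_p),V(C_1))$-paths $Q_1,Q_2$. Then $D[V_2]+C$ is strong. Moreover, if $D[V_2]+C$ is not 2-arc-strong and $xy$ is a cut-arc of $D[V_2]+C$, then $xy\notin C$ and at least one of the following holds: ($\beta1$) $V(C_p)=\{y\}$, $V(C_{p-1})=\{x\}$ and $d^+_{D[V_2]+C}(x)=1$; ($\beta2$) $V(C_1)=\{x\}$, $V(C_2)=\{y\}$ and $d^-_{D[V_2]+C}(y)=1$; ($\beta3$) $xy$ is an arc of $D[V(C_p)]$; ($\beta4$) $xy$ is an arc of $D[V(C_1)]$.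
   Context: A split digraph $D=(V_1,V_2;A)$ is a digraph whose vertex set is partitioned into an independent set $V_1$ and a set $V_2$ inducing a semicomplete digraph (every two distinct vertices of $V_2$ are joined by at least one arc); $D[X]$ denotes the subdigraph induced by $X$. A (multi-)digraph is strong if every vertex can reach every other by a directed path, and 2-arc-strong if it remains strong after deleting any single arc (one copy, for parallel arcs); an arc $e$ of a strong (multi-)digraph $H$ is a cut-arc if $H-e$ is not strong. The strong components $C_1,\dots,C_p$ of a semicomplete digraph are ordered acyclically, i.e. there is no arc from $C_j$ to $C_i$ when $j>i$ (this ordering is unique). $D[V_2]+C$ denotes the multi-digraph on $V_2$ whose arc multiset is $A(D[V_2])$ together with $C$. For vertex sets $X,Y$, an $(X,Y)$-path is a directed path starting at a vertex of $X$ and ending at a vertex of $Y$ whose only vertices in $X\cup Y$ are its two endpoints. $d^+_H$, $d^-_H$ denote out- and in-degree in $H$. -}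

module Defs where

open import Data.Nat using (ℕ; zero; suc)
open import Data.Fin using (Fin; zero; suc; fromℕ; inject₁; _≤_; _≟_)
open import Data.Fin.Properties using () renaming (_≟_ to _≟ᶠ_)
open import Data.Bool using (Bool; true; false; _∧_; if_then_else_)
open import Data.Product using (_×_; _,_; proj₁; proj₂; ∃)
open import Data.Sum using (_⊎_)
open import Data.List using (List; length; filterᵇ; cartesianProduct; allFin; _++_; removeAt; lookup)
open import Data.List.Membership.Propositional using (_∈_)
open import Data.List.Relation.Unary.All using (All)
open import Relation.Nullary using (¬_; does)
open import Relation.Binary.PropositionalEquality using (_≡_; _≢_)
open import Relation.Binary.Construct.Closure.ReflexiveTransitive using (Star)
open import Function.Definitions using (Injective)
open import Function.Bundles using (_⇔_)

-- A digraph on the vertex set Fin n is given by a Boolean adjacency function.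
-- A multi-digraph is given by a finite list of arcs (u , v); repeated entries
-- are parallel arcs, and an individual arc (copy) is identified by its
-- position in the list.

MultiDigraph : ℕ → Set
MultiDigraph n = List (Fin n × Fin n)

-- Split digraph D = (V₁, V₂; A): V₂ is given by its characteristic function,
-- V₁ is its complement.
record IsSplitDigraph (n : ℕ) (A : Fin n → Fin n → Bool) (V₂ : Fin n → Bool) : Set where
  field
    loopless   : ∀ u → A u u ≡ false
    V₁-indep   : ∀ u v → V₂ u ≡ false → V₂ v ≡ false → A u v ≡ false
    V₂-semicomplete : ∀ u v → V₂ u ≡ true → V₂ v ≡ true → u ≢ v →
                      (A u v ≡ true) ⊎ (A v u ≡ true)

module _ {n : ℕ} where

  ArcOf : MultiDigraph n → Fin n → Fin n → Set
  ArcOf E u v = (u , v) ∈ E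

  Reaches : MultiDigraph n → Fin n → Fin n → Set
  Reaches E = Star (ArcOf E)

  StrongOn : (Fin n → Bool) → MultiDigraph n → Set
  StrongOn X E = ∀ u v → X u ≡ true → X v ≡ true → Reaches E u v

  TwoArcStrongOn : (Fin n → Bool) → MultiDigraph n → Set
  TwoArcStrongOn X E = StrongOn X E × (∀ (e : Fin (length E)) → StrongOn X (removeAt E e))

  IsCutArc : (Fin n → Bool) → (E : MultiDigraph n) → Fin (length E) → Set
  IsCutArc X E e = StrongOn X E × ¬ StrongOn X (removeAt E e)

  inducedArcs : (Fin n → Fin n → Bool) → (Fin n → Bool) → MultiDigraph n
  inducedArcs A X =
    filterᵇ (λ p → X (proj₁ p) ∧ X (proj₂ p) ∧ A (proj₁ p) (proj₂ p))
            (cartesianProduct (allFin n) (allFin n))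

  outdeg : MultiDigraph n → Fin n → ℕ
  outdeg E x = length (filterᵇ (λ p → does (proj₁ p ≟ᶠ x)) E)

  indeg : MultiDigraph n → Fin n → ℕ
  indeg E y = length (filterᵇ (λ p → does (proj₂ p ≟ᶠ y)) E)

  record Path (E : MultiDigraph n) : Set where
    field
      len     : ℕ
      vtx     : Fin (suc len) → Fin n
      arc     : Fin len → Fin (length E)
      arc-ok  : ∀ i → lookup E (arc i) ≡ (vtx (inject₁ i) , vtx (suc i))
      vtx-inj : Injective _≡_ _≡_ vtx
    start : Fin n
    start = vtx zero
    end : Fin n
    end = vtx (fromℕ len)

  IsXYPath : {E : MultiDigraph n} → (Fin n → Set) → (Fin n → Set) → Path E → Set
  IsXYPath X Y P =
    X (Path.start P) × Y (Path.end P) ×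
    (∀ i → (X (Path.vtx P i) ⊎ Y (Path.vtx P i)) → (i ≡ zero) ⊎ (i ≡ fromℕ (Path.len P)))

  ArcDisjoint : {E : MultiDigraph n} → Path E → Path E → Set
  ArcDisjoint P Q = ∀ i j → Path.arc P i ≢ Path.arc Q j

  -- comp : Fin n → Fin p is the acyclic ordering C_1 , … , C_p of the strong
  -- components of D[V₂] = (V₂, E): vertex v ∈ V₂ lies in C_(comp v + 1).
  InComp : {p : ℕ} → (Fin n → Bool) → (Fin n → Fin p) → Fin n → Fin p → Set
  InComp V₂ comp v i = (V₂ v ≡ true) × (comp v ≡ i)

  record IsAcyclicOrderingOfStrongComponents (V₂ : Fin n → Bool) (E : MultiDigraph n)
           (p : ℕ) (comp : Fin n → Fin p) : Set where
    field
      sameComp⇔strong : ∀ u v → V₂ u ≡ true → V₂ v ≡ true →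
                        (comp u ≡ comp v) ⇔ (Reaches E u v × Reaches E v u)
      nonempty : ∀ i → ∃ λ v → InComp V₂ comp v i
      acyclic : ∀ u v → V₂ u ≡ true → V₂ v ≡ true → ArcOf E u v → comp u ≤ comp v

-- Arcs of D[V₂] between distinct strong components all point forward, so u
-- reaches v in D[V₂] iff comp u ≤ comp v; hence any multi-digraph containing
-- D[V₂] and a walk from C_p to C_1 is strong.  Deleting one arc destroys at
-- most one of Q₁, Q₂, so a cut-arc xy must be an arc of D[V₂] occurring once
-- in D[V₂]+C, and its deletion must destroy every x–y walk.  If x ∉ C_1 and
-- y ∉ C_p, then x → C_p ⇝ C_1 → y is such a walk.  Otherwise, when x and y lie
-- in different components, a second vertex in either of their components, a
-- component strictly between them, or a second in-neighbour of y (out-neighbour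
-- of x) would give one; this is (β2) for x ∈ C_1 and (β1) for y ∈ C_p.
module Submission where

open import Defs
open import Data.Nat using (ℕ; zero; suc; _+_; z≤n; s≤s)
import Data.Nat.Properties as ℕ
open import Data.Fin using (Fin; zero; suc; fromℕ; inject₁; _≤_; _<_; pred)
open import Data.Fin.Properties using (_≟_; ≤fromℕ; ≤∧≢⇒<; ≤-antisym; ≤-reflexive; <⇒≤pred; pred<; <-irrefl; any?)
open import Data.Bool using (Bool; true; false; _∧_; T)
open import Data.Bool.Properties using (T?)
open import Data.Product using (_×_; _,_; proj₁; proj₂; ∃₂)
open import Data.Product.Properties using (≡-dec)
open import Data.Sum using (_⊎_; inj₁; inj₂; [_,_]′)
open import Data.Empty using (⊥; ⊥-elim)
open import Data.Unit using (tt)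
open import Data.List using (List; []; _∷_; _++_; length; lookup; removeAt; filterᵇ; cartesianProduct; allFin)
open import Data.List.Properties using (filter-++; filter-none; length-++)
open import Data.List.Membership.Propositional using (_∈_; _∉_)
open import Data.List.Membership.Propositional.Properties using (∈-lookup; ∈-++⁺ˡ; ∈-++⁺ʳ; ∈-++⁻; ∈-filter⁺; ∈-filter⁻; ∈-cartesianProduct⁺; ∈-allFin)
open import Data.List.Relation.Unary.All as All using (All; []; _∷_)
open import Data.List.Relation.Unary.Any using (here; there; index)
open import Data.List.Relation.Unary.Any.Properties using (lookup-index)
open import Data.List.Relation.Unary.AllPairs using ([]; _∷_)
open import Data.List.Relation.Unary.Unique.Propositional using (Unique)
import Data.List.Relation.Unary.Unique.Propositional.Properties as Unique
open import Relation.Nullary using (¬_; Dec; yes; no; does)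
open import Relation.Nullary.Decidable using (decidable-stable)
open import Relation.Binary.PropositionalEquality using (_≡_; _≢_; refl; sym; trans; cong; cong₂; subst; module ≡-Reasoning)
open import Relation.Binary.Construct.Closure.ReflexiveTransitive using (Star; ε; _◅_; _◅◅_; _⋆)
  renaming (map to Star-map)
open import Function using (_∘_)
open import Function.Bundles using (_⇔_; mk⇔; Equivalence)

module _ {a} {X : Set a} where

  lookup∈removeAt : (xs : List X) {i e : Fin (length xs)} → i ≢ e → lookup xs i ∈ removeAt xs e
  lookup∈removeAt (_ ∷ _)  {zero}  {zero}  i≢e = ⊥-elim (i≢e refl)
  lookup∈removeAt (_ ∷ _)  {zero}  {suc _} _   = here refl
  lookup∈removeAt (_ ∷ xs) {suc i} {zero}  _   = ∈-lookup i
  lookup∈removeAt (_ ∷ xs) {suc i} {suc e} i≢e = there (lookup∈removeAt xs (i≢e ∘ cong suc))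

  ∈-removeAt⁺ : {xs : List X} (e : Fin (length xs)) {x : X} → x ∈ xs → x ≢ lookup xs e → x ∈ removeAt xs e
  ∈-removeAt⁺ {xs} e x∈xs x≢ with index x∈xs ≟ e
  ... | yes refl = ⊥-elim (x≢ (lookup-index x∈xs))
  ... | no i≢e   = subst (_∈ removeAt xs e) (sym (lookup-index x∈xs)) (lookup∈removeAt xs i≢e)

  ∈-removeAt-++ : {xs ys : List X} {x : X} → x ∈ xs → x ∈ ys → ∀ e → x ∈ removeAt (xs ++ ys) e
  ∈-removeAt-++ {_ ∷ xs} (here refl) x∈ys zero    = ∈-++⁺ʳ xs x∈ys
  ∈-removeAt-++          (here refl) x∈ys (suc e) = here refl
  ∈-removeAt-++          (there x∈xs) x∈ys zero    = ∈-++⁺ˡ x∈xs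
  ∈-removeAt-++          (there x∈xs) x∈ys (suc e) = there (∈-removeAt-++ x∈xs x∈ys e)

  Unique∧All≡⇒length≡1 : {c : X} {ys : List X} → Unique ys → All (_≡ c) ys → c ∈ ys → length ys ≡ 1
  Unique∧All≡⇒length≡1 {ys = _ ∷ []}    _                  _                _ = refl
  Unique∧All≡⇒length≡1 {ys = _ ∷ _ ∷ _} ((y≢y′ ∷ _) ∷ _) (refl ∷ refl ∷ _) _ = ⊥-elim (y≢y′ refl)

false≢true : false ≢ true
false≢true ()

T-does⁻ : ∀ {a} {P : Set a} (P? : Dec P) → T (does P?) → P
T-does⁻ (yes p) _ = p

T-does⁺ : ∀ {a} {P : Set a} (P? : Dec P) → P → T (does P?)
T-does⁺ (yes _) _  = tt
T-does⁺ (no ¬p) p = ¬p p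

chain⇒Star : ∀ {a r} {I : Set a} {R : I → I → Set r} (len : ℕ) (v : Fin (suc len) → I) →
             (∀ i → R (v (inject₁ i)) (v (suc i))) → Star R (v zero) (v (fromℕ len))
chain⇒Star zero    v step = ε
chain⇒Star (suc m) v step = step zero ◅ chain⇒Star m (v ∘ suc) (step ∘ suc)

module _ {n : ℕ} where

  Path⇒Reaches : {H G : MultiDigraph n} (P : Path H) →
                 (∀ i → lookup H (Path.arc P i) ∈ G) → Reaches G (Path.start P) (Path.end P)
  Path⇒Reaches {H} {G} P arcs∈G =
    chain⇒Star (Path.len P) (Path.vtx P) (λ i → subst (_∈ G) (Path.arc-ok P i) (arcs∈G i))

  StrongOn-reroute : {X : Fin n → Bool} {H G : MultiDigraph n} →
                     (∀ {u v} → ArcOf H u v → Reaches G u v) → StrongOn X H → StrongOn X G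
  StrongOn-reroute reroute strong u v Xu Xv = (reroute ⋆) (strong u v Xu Xv)

  arcDisjoint-avoid : {H : MultiDigraph n} {P Q : Path H} → ArcDisjoint P Q → ∀ e →
                      (∀ i → Path.arc P i ≢ e) ⊎ (∀ j → Path.arc Q j ≢ e)
  arcDisjoint-avoid {P = P} disj e with any? (λ i → Path.arc P i ≟ e)
  ... | yes (i , Pi≡e) = inj₂ (λ j Qj≡e → disj i j (trans Pi≡e (sym Qj≡e)))
  ... | no  ¬P∋e       = inj₁ (λ i Pi≡e → ¬P∋e (i , Pi≡e))

module InducedArcs {n : ℕ} (A : Fin n → Fin n → Bool) (X : Fin n → Bool) where

  ∈-inducedArcs⁺ : ∀ {u v} → X u ≡ true → X v ≡ true → A u v ≡ true → (u , v) ∈ inducedArcs A X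
  ∈-inducedArcs⁺ {u} {v} Xu Xv Auv =
    ∈-filter⁺ (T? ∘ _) (∈-cartesianProduct⁺ (∈-allFin u) (∈-allFin v)) (T-∧³⁺ Xu Xv Auv)
    where
    T-∧³⁺ : ∀ {a b c} → a ≡ true → b ≡ true → c ≡ true → T (a ∧ b ∧ c)
    T-∧³⁺ refl refl refl = tt

  ∈-inducedArcs⁻ : ∀ {u v} → (u , v) ∈ inducedArcs A X → X u ≡ true × X v ≡ true × A u v ≡ true
  ∈-inducedArcs⁻ {u} {v} uv∈ =
    T-∧³⁻ (X u) (X v) (A u v) (proj₂ (∈-filter⁻ (T? ∘ _) {xs = cartesianProduct (allFin n) (allFin n)} uv∈))
    where
    T-∧³⁻ : ∀ a b c → T (a ∧ b ∧ c) → a ≡ true × b ≡ true × c ≡ true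
    T-∧³⁻ true true true _ = refl , refl , refl

  inducedArcs-unique : Unique (inducedArcs A X)
  inducedArcs-unique = Unique.filter⁺ (T? ∘ _) (Unique.cartesianProduct⁺ (Unique.allFin⁺ n) (Unique.allFin⁺ n))

module AcyclicOrdering {n : ℕ} {A : Fin n → Fin n → Bool} {V₂ : Fin n → Bool} (SD : IsSplitDigraph n A V₂)
  {p : ℕ} {comp : Fin n → Fin p}
  (AO : IsAcyclicOrderingOfStrongComponents V₂ (inducedArcs A V₂) p comp) where

  open IsSplitDigraph SD
  open IsAcyclicOrderingOfStrongComponents AO
  open InducedArcs A V₂ public

  D₂ : MultiDigraph n
  D₂ = inducedArcs A V₂

  arc-comp-≤ : ∀ {u v} → ArcOf D₂ u v → comp u ≤ comp v
  arc-comp-≤ uv∈ with ∈-inducedArcs⁻ uv∈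
  ... | V₂u , V₂v , _ = acyclic _ _ V₂u V₂v uv∈

  Reaches⇒comp-≤ : ∀ {u v} → Reaches D₂ u v → comp u ≤ comp v
  Reaches⇒comp-≤ ε           = ℕ.≤-refl
  Reaches⇒comp-≤ (uw ◅ w⇝v) = ℕ.≤-trans (arc-comp-≤ uw) (Reaches⇒comp-≤ w⇝v)

  forward-arc : ∀ {u v} → V₂ u ≡ true → V₂ v ≡ true → comp u < comp v → ArcOf D₂ u v
  forward-arc {u} {v} V₂u V₂v cu<cv with u ≟ v
  ... | yes refl = ⊥-elim (<-irrefl refl cu<cv)
  ... | no u≢v with V₂-semicomplete u v V₂u V₂v u≢v
  ...   | inj₁ Auv = ∈-inducedArcs⁺ V₂u V₂v Auv
  ...   | inj₂ Avu = ⊥-elim (ℕ.<⇒≱ cu<cv (arc-comp-≤ (∈-inducedArcs⁺ V₂v V₂u Avu)))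

  comp-≤⇒Reaches : ∀ {u v} → V₂ u ≡ true → V₂ v ≡ true → comp u ≤ comp v → Reaches D₂ u v
  comp-≤⇒Reaches {u} {v} V₂u V₂v cu≤cv with comp u ≟ comp v
  ... | yes cu≡cv = proj₁ (Equivalence.to (sameComp⇔strong u v V₂u V₂v) cu≡cv)
  ... | no  cu≢cv = forward-arc V₂u V₂v (≤∧≢⇒< cu≤cv cu≢cv) ◅ ε

  InsideArc : Fin p → Fin n → Fin n → Set
  InsideArc k u v = ArcOf D₂ u v × comp u ≡ k × comp v ≡ k

  Reaches⇒inside : ∀ {u v k} → Reaches D₂ u v → comp u ≡ k → comp v ≡ k → Star (InsideArc k) u v
  Reaches⇒inside ε _ _ = ε
  Reaches⇒inside {k = k} (_◅_ {j = w} uw w⇝v) cu cv = (uw , cu , cw) ◅ Reaches⇒inside w⇝v cw cv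
    where
    cw : comp w ≡ k
    cw = ≤-antisym (subst (comp w ≤_) cv (Reaches⇒comp-≤ w⇝v)) (subst (_≤ comp w) cu (arc-comp-≤ uw))

  reaches-inside : ∀ {u v} → V₂ u ≡ true → V₂ v ≡ true → comp u ≡ comp v → Star (InsideArc (comp u)) u v
  reaches-inside V₂u V₂v cu≡cv = Reaches⇒inside (comp-≤⇒Reaches V₂u V₂v (≤-reflexive cu≡cv)) refl (sym cu≡cv)

module TwoPathCompletion {n : ℕ} {A : Fin n → Fin n → Bool} {V₂ : Fin n → Bool} (SD : IsSplitDigraph n A V₂)
  {q : ℕ} {comp : Fin n → Fin (suc (suc q))}
  (AO : IsAcyclicOrderingOfStrongComponents V₂ (inducedArcs A V₂) (suc (suc q)) comp)
  (C : MultiDigraph n)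
  (C-ok : All (λ a → (V₂ (proj₁ a) ≡ true) × (V₂ (proj₂ a) ≡ true) × (proj₁ a ≢ proj₂ a)) C)
  (Q₁ Q₂ : Path (inducedArcs A V₂ ++ C))
  (Q₁-ok : IsXYPath (λ v → InComp V₂ comp v (fromℕ (suc q))) (λ v → InComp V₂ comp v zero) Q₁)
  (Q₂-ok : IsXYPath (λ v → InComp V₂ comp v (fromℕ (suc q))) (λ v → InComp V₂ comp v zero) Q₂)
  (disj : ArcDisjoint Q₁ Q₂) where

  open IsSplitDigraph SD
  open IsAcyclicOrderingOfStrongComponents AO
  open AcyclicOrdering SD AO

  last : Fin (suc (suc q))
  last = fromℕ (suc q)

  H : MultiDigraph n
  H = D₂ ++ C

  H-arc-ends : ∀ {u v} → (u , v) ∈ H → V₂ u ≡ true × V₂ v ≡ true × u ≢ v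
  H-arc-ends uv∈H with ∈-++⁻ D₂ uv∈H
  ... | inj₂ uv∈C  = All.lookup C-ok uv∈C
  ... | inj₁ uv∈D₂ with ∈-inducedArcs⁻ uv∈D₂
  ...   | V₂u , V₂v , Auv = V₂u , V₂v , λ { refl → false≢true (trans (sym (loopless _)) Auv) }

  LastReachesFirst : MultiDigraph n → Set
  LastReachesFirst G = ∃₂ λ s t → InComp V₂ comp s last × InComp V₂ comp t zero × Reaches G s t

  strong-if-LastReachesFirst : {G : MultiDigraph n} → (∀ {a} → a ∈ D₂ → a ∈ G) → LastReachesFirst G → StrongOn V₂ G
  strong-if-LastReachesFirst {G} D₂⊆G (s , t , (V₂s , cs) , (V₂t , ct) , s⇝t) u v V₂u V₂v =
    inG (comp-≤⇒Reaches V₂u V₂s u≤s) ◅◅ s⇝t ◅◅ inG (comp-≤⇒Reaches V₂t V₂v t≤v)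
    where
    inG : ∀ {a b} → Reaches D₂ a b → Reaches G a b
    inG = Star-map D₂⊆G
    u≤s : comp u ≤ comp s
    u≤s = subst (comp u ≤_) (sym cs) (≤fromℕ (comp u))
    t≤v : comp t ≤ comp v
    t≤v = subst (_≤ comp v) (sym ct) z≤n

  Path⇒LastReachesFirst : {G : MultiDigraph n} (Q : Path H) →
    IsXYPath (λ v → InComp V₂ comp v last) (λ v → InComp V₂ comp v zero) Q →
    (∀ i → lookup H (Path.arc Q i) ∈ G) → LastReachesFirst G
  Path⇒LastReachesFirst Q (s-ok , t-ok , _) arcs∈G = _ , _ , s-ok , t-ok , Path⇒Reaches Q arcs∈G

  H-strong : StrongOn V₂ H
  H-strong = strong-if-LastReachesFirst ∈-++⁺ˡ (Path⇒LastReachesFirst Q₁ Q₁-ok (∈-lookup ∘ Path.arc Q₁))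

  LastReachesFirst-removeAt : ∀ e → LastReachesFirst (removeAt H e)
  LastReachesFirst-removeAt e =
    [ (λ Q₁≢e → Path⇒LastReachesFirst Q₁ Q₁-ok (λ i → lookup∈removeAt H (Q₁≢e i)))
    , (λ Q₂≢e → Path⇒LastReachesFirst Q₂ Q₂-ok (λ j → lookup∈removeAt H (Q₂≢e j)))
    ]′ (arcDisjoint-avoid {P = Q₁} {Q = Q₂} disj e)

  module CutArc {x y : Fin n} {e : Fin (length H)} (e↦xy : lookup H e ≡ (x , y)) (cut : IsCutArc V₂ H e) where

    G : MultiDigraph n
    G = removeAt H e

    survives : ∀ {a} → a ∈ H → a ≢ (x , y) → a ∈ G
    survives a∈H a≢xy = ∈-removeAt⁺ e a∈H (λ a≡ → a≢xy (trans a≡ e↦xy))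

    no-detour : ¬ Reaches G x y
    no-detour x⇝y = proj₂ cut (StrongOn-reroute reroute (proj₁ cut))
      where
      reroute : ∀ {u v} → ArcOf H u v → Reaches G u v
      reroute {u} {v} uv∈H with ≡-dec _≟_ _≟_ (u , v) (x , y)
      ... | yes refl  = x⇝y
      ... | no uv≢xy = survives uv∈H uv≢xy ◅ ε

    -- If A x y holds, xy ∈ C would be parallel to an arc of D[V₂]; otherwise deleting it keeps all of D[V₂].
    cut-arc-∉C : (x , y) ∉ C
    cut-arc-∉C xy∈C with All.lookup C-ok xy∈C | A x y in Axy
    ... | V₂x , V₂y , _ | true  = no-detour (∈-removeAt-++ (∈-inducedArcs⁺ V₂x V₂y Axy) xy∈C e ◅ ε)
    ... | _             | false = proj₂ cut (strong-if-LastReachesFirst D₂⊆G (LastReachesFirst-removeAt e))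
      where
      D₂⊆G : ∀ {a} → a ∈ D₂ → a ∈ G
      D₂⊆G a∈D₂ = survives (∈-++⁺ˡ a∈D₂) λ { refl → false≢true (trans (sym Axy) (proj₂ (proj₂ (∈-inducedArcs⁻ a∈D₂)))) }

    cut-arc-∈D₂ : (x , y) ∈ D₂
    cut-arc-∈D₂ with ∈-++⁻ D₂ (subst (_∈ H) e↦xy (∈-lookup e))
    ... | inj₁ xy∈D₂ = xy∈D₂
    ... | inj₂ xy∈C  = ⊥-elim (cut-arc-∉C xy∈C)

    V₂x : V₂ x ≡ true
    V₂x = proj₁ (∈-inducedArcs⁻ cut-arc-∈D₂)

    V₂y : V₂ y ≡ true
    V₂y = proj₁ (proj₂ (∈-inducedArcs⁻ cut-arc-∈D₂))

    Axy : A x y ≡ true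
    Axy = proj₂ (proj₂ (∈-inducedArcs⁻ cut-arc-∈D₂))

    cx≤cy : comp x ≤ comp y
    cx≤cy = arc-comp-≤ cut-arc-∈D₂

    arc-survives : ∀ {u v} → V₂ u ≡ true → V₂ v ≡ true → comp u < comp v → u ≢ x ⊎ v ≢ y → Reaches G u v
    arc-survives {u} {v} V₂u V₂v cu<cv u≢x⊎v≢y = survives (∈-++⁺ˡ (forward-arc V₂u V₂v cu<cv)) uv≢xy ◅ ε
      where
      uv≢xy : (u , v) ≢ (x , y)
      uv≢xy refl = [ (λ x≢x → x≢x refl) , (λ y≢y → y≢y refl) ]′ u≢x⊎v≢y

    inside-survives : ∀ {u v} → V₂ u ≡ true → V₂ v ≡ true → comp u ≡ comp v →
                      comp u ≢ comp x ⊎ comp u ≢ comp y → Reaches G u v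
    inside-survives {u} V₂u V₂v cu≡cv k≢ = Star-map keep (reaches-inside V₂u V₂v cu≡cv)
      where
      keep : ∀ {a b} → InsideArc (comp u) a b → ArcOf G a b
      keep (ab∈D₂ , ca , cb) = survives (∈-++⁺ˡ ab∈D₂)
        λ { refl → [ (λ k≢cx → k≢cx (sym ca)) , (λ k≢cy → k≢cy (sym cb)) ]′ k≢ }

    cut-arc-at-end : comp x ≡ zero ⊎ comp y ≡ last
    cut-arc-at-end with comp x ≟ zero | comp y ≟ last
    ... | yes cx≡0 | _           = inj₁ cx≡0
    ... | no _     | yes cy≡last = inj₂ cy≡last
    ... | no cx≢0  | no cy≢last with LastReachesFirst-removeAt e
    ...   | s , t , (V₂s , cs) , (V₂t , ct) , s⇝t =
      ⊥-elim (no-detour (arc-survives V₂x V₂s cx<cs (inj₂ s≢y) ◅◅ s⇝t ◅◅ arc-survives V₂t V₂y ct<cy (inj₁ t≢x)))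
      where
      cx<cs : comp x < comp s
      cx<cs = subst (comp x <_) (sym cs) (ℕ.≤-<-trans cx≤cy (≤∧≢⇒< (≤fromℕ (comp y)) cy≢last))
      ct<cy : comp t < comp y
      ct<cy = subst (_< comp y) (sym ct) (ℕ.<-≤-trans (≤∧≢⇒< z≤n (cx≢0 ∘ sym)) cx≤cy)
      s≢y : s ≢ y
      s≢y refl = cy≢last cs
      t≢x : t ≢ x
      t≢x refl = cx≢0 ct

    module _ (cx≢cy : comp x ≢ comp y) where

      cx<cy : comp x < comp y
      cx<cy = ≤∧≢⇒< cx≤cy cx≢cy

      component-of-x : ∀ {k} → comp x ≡ k → ∀ v → InComp V₂ comp v k ⇔ (v ≡ x)
      component-of-x refl v = mk⇔ only-x (λ { refl → V₂x , refl })
        where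
        only-x : InComp V₂ comp v (comp x) → v ≡ x
        only-x (V₂v , cv) = decidable-stable (v ≟ x) λ v≢x →
          no-detour (inside-survives V₂x V₂v (sym cv) (inj₂ cx≢cy) ◅◅
                     arc-survives V₂v V₂y (subst (_< comp y) (sym cv) cx<cy) (inj₁ v≢x))

      component-of-y : ∀ {k} → comp y ≡ k → ∀ v → InComp V₂ comp v k ⇔ (v ≡ y)
      component-of-y refl v = mk⇔ only-y (λ { refl → V₂y , refl })
        where
        only-y : InComp V₂ comp v (comp y) → v ≡ y
        only-y (V₂v , cv) = decidable-stable (v ≟ y) λ v≢y →
          no-detour (arc-survives V₂x V₂v (subst (comp x <_) (sym cv) cx<cy) (inj₂ v≢y) ◅◅
                     inside-survives V₂v V₂y cv (inj₁ λ cv≡cx → cx≢cy (trans (sym cv≡cx) cv)))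

      no-component-between : ∀ {k} → comp x < k → k < comp y → ⊥
      no-component-between {k} cx<k k<cy with nonempty k
      ... | u , V₂u , cu =
        no-detour (arc-survives V₂x V₂u (subst (comp x <_) (sym cu) cx<k) (inj₂ u≢y) ◅◅
                   arc-survives V₂u V₂y (subst (_< comp y) (sym cu) k<cy) (inj₁ u≢x))
        where
        u≢y : u ≢ y
        u≢y refl = <-irrefl (sym cu) k<cy
        u≢x : u ≢ x
        u≢x refl = <-irrefl cu cx<k

      from-first-component : comp x ≡ zero → ∀ {v} → V₂ v ≡ true → v ≢ y → Reaches G x v
      from-first-component cx≡0 {v} V₂v v≢y with comp v ≟ zero
      ... | yes cv≡0 = inside-survives V₂x V₂v (trans cx≡0 (sym cv≡0)) (inj₂ cx≢cy)
      ... | no  cv≢0 = arc-survives V₂x V₂v (subst (_< comp v) (sym cx≡0) (≤∧≢⇒< z≤n (cv≢0 ∘ sym))) (inj₂ v≢y)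

      into-last-component : comp y ≡ last → ∀ {u} → V₂ u ≡ true → u ≢ x → Reaches G u y
      into-last-component cy≡last {u} V₂u u≢x with comp u ≟ last
      ... | yes cu≡last = inside-survives V₂u V₂y cu≡cy (inj₁ λ cu≡cx → cx≢cy (trans (sym cu≡cx) cu≡cy))
        where
        cu≡cy : comp u ≡ comp y
        cu≡cy = trans cu≡last (sym cy≡last)
      ... | no  cu≢last = arc-survives V₂u V₂y (subst (comp u <_) (sym cy≡last) (≤∧≢⇒< (≤fromℕ (comp u)) cu≢last)) (inj₁ u≢x)

    length-filter-H≡1 : (P : Fin n × Fin n → Bool) → T (P (x , y)) →
                        (∀ {a} → a ∈ H → T (P a) → a ≡ (x , y)) → length (filterᵇ P H) ≡ 1
    length-filter-H≡1 P Pxy only-xy = let open ≡-Reasoning in begin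
      length (filterᵇ P (D₂ ++ C))                 ≡⟨ cong length (filter-++ (T? ∘ P) D₂ C) ⟩
      length (filterᵇ P D₂ ++ filterᵇ P C)         ≡⟨ length-++ (filterᵇ P D₂) ⟩
      length (filterᵇ P D₂) + length (filterᵇ P C) ≡⟨ cong₂ _+_ in-D₂ (cong length in-C) ⟩
      1                                            ∎
      where
      in-D₂ : length (filterᵇ P D₂) ≡ 1
      in-D₂ = Unique∧All≡⇒length≡1 (Unique.filter⁺ (T? ∘ P) inducedArcs-unique)
        (All.tabulate λ a∈ → let a∈D₂ , Pa = ∈-filter⁻ (T? ∘ P) {xs = D₂} a∈ in only-xy (∈-++⁺ˡ a∈D₂) Pa)
        (∈-filter⁺ (T? ∘ P) cut-arc-∈D₂ Pxy)
      in-C : filterᵇ P C ≡ []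
      in-C = filter-none (T? ∘ P) (All.tabulate λ a∈C Pa →
        cut-arc-∉C (subst (_∈ C) (only-xy (∈-++⁺ʳ D₂ a∈C) Pa) a∈C))

    indeg≡1 : comp x ≡ zero → comp x ≢ comp y → indeg H y ≡ 1
    indeg≡1 cx≡0 cx≢cy = length-filter-H≡1 (λ a → does (proj₂ a ≟ y)) (T-does⁺ (y ≟ y) refl) only-from-x
      where
      only-from-x : ∀ {a} → a ∈ H → T (does (proj₂ a ≟ y)) → a ≡ (x , y)
      only-from-x {u , v} uv∈H v≟y with T-does⁻ (v ≟ y) v≟y | H-arc-ends uv∈H
      ... | refl | V₂u , _ , u≢y = cong (_, y) (decidable-stable (u ≟ x) λ u≢x →
        no-detour (from-first-component cx≢cy cx≡0 V₂u u≢y ◅◅ survives uv∈H (λ { refl → u≢x refl }) ◅ ε))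

    outdeg≡1 : comp y ≡ last → comp x ≢ comp y → outdeg H x ≡ 1
    outdeg≡1 cy≡last cx≢cy = length-filter-H≡1 (λ a → does (proj₁ a ≟ x)) (T-does⁺ (x ≟ x) refl) only-to-y
      where
      only-to-y : ∀ {a} → a ∈ H → T (does (proj₁ a ≟ x)) → a ≡ (x , y)
      only-to-y {u , v} uv∈H u≟x with T-does⁻ (u ≟ x) u≟x | H-arc-ends uv∈H
      ... | refl | _ , V₂v , x≢v = cong (x ,_) (decidable-stable (v ≟ y) λ v≢y →
        no-detour (survives uv∈H (λ { refl → v≢y refl }) ◅ into-last-component cx≢cy cy≡last V₂v (x≢v ∘ sym)))

    -- pred last reduces to inject₁ (fromℕ q), the index of C_{p-1}.
    β₁ β₂ β₃ β₄ : Set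
    β₁ = (∀ v → InComp V₂ comp v last ⇔ (v ≡ y)) × (∀ v → InComp V₂ comp v (pred last) ⇔ (v ≡ x)) ×
         outdeg H x ≡ 1
    β₂ = (∀ v → InComp V₂ comp v zero ⇔ (v ≡ x)) × (∀ v → InComp V₂ comp v (suc zero) ⇔ (v ≡ y)) ×
         indeg H y ≡ 1
    β₃ = InComp V₂ comp x last × InComp V₂ comp y last × A x y ≡ true
    β₄ = InComp V₂ comp x zero × InComp V₂ comp y zero × A x y ≡ true

    sink-case : comp x ≢ comp y → comp y ≡ last → β₁
    sink-case cx≢cy cy≡last = component-of-y cx≢cy cy≡last , component-of-x cx≢cy cx≡pred , outdeg≡1 cy≡last cx≢cy
      where
      cx≡pred : comp x ≡ pred last
      cx≡pred = decidable-stable (comp x ≟ pred last) λ cx≢pred →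
        no-component-between cx≢cy (≤∧≢⇒< (<⇒≤pred (subst (comp x <_) cy≡last (cx<cy cx≢cy))) cx≢pred)
                                   (subst (pred last <_) (sym cy≡last) (pred< last λ ()))

    source-case : comp x ≢ comp y → comp x ≡ zero → β₂
    source-case cx≢cy cx≡0 = component-of-x cx≢cy cx≡0 , component-of-y cx≢cy cy≡1 , indeg≡1 cx≡0 cx≢cy
      where
      cy≡1 : comp y ≡ suc zero
      cy≡1 = decidable-stable (comp y ≟ suc zero) λ cy≢1 →
        no-component-between cx≢cy (subst (_< suc (zero {n = q})) (sym cx≡0) (s≤s z≤n))
                                   (≤∧≢⇒< (subst (_< comp y) cx≡0 (cx<cy cx≢cy)) (cy≢1 ∘ sym))

    classification : (β₁ ⊎ β₂) ⊎ (β₃ ⊎ β₄)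
    classification with comp x ≟ comp y | cut-arc-at-end
    ... | yes cx≡cy | inj₁ cx≡0    = inj₂ (inj₂ ((V₂x , cx≡0) , (V₂y , trans (sym cx≡cy) cx≡0) , Axy))
    ... | yes cx≡cy | inj₂ cy≡last = inj₂ (inj₁ ((V₂x , trans cx≡cy cy≡last) , (V₂y , cy≡last) , Axy))
    ... | no  cx≢cy | inj₁ cx≡0    = inj₁ (inj₂ (source-case cx≢cy cx≡0))
    ... | no  cx≢cy | inj₂ cy≡last = inj₁ (inj₁ (sink-case cx≢cy cy≡last))

lemma3p4 : (n : ℕ) (A : Fin n → Fin n → Bool) (V₂ : Fin n → Bool) →
    IsSplitDigraph n A V₂ →
    ¬ StrongOn V₂ (inducedArcs A V₂) →
    (q : ℕ) (comp : Fin n → Fin (suc (suc q))) →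
    IsAcyclicOrderingOfStrongComponents V₂ (inducedArcs A V₂) (suc (suc q)) comp →
    (C : List (Fin n × Fin n)) →
    All (λ a → (V₂ (proj₁ a) ≡ true) × (V₂ (proj₂ a) ≡ true) × (proj₁ a ≢ proj₂ a)) C →
    (Q₁ Q₂ : Path (inducedArcs A V₂ ++ C)) →
    IsXYPath (λ v → InComp V₂ comp v (fromℕ (suc q))) (λ v → InComp V₂ comp v zero) Q₁ →
    IsXYPath (λ v → InComp V₂ comp v (fromℕ (suc q))) (λ v → InComp V₂ comp v zero) Q₂ →
    ArcDisjoint Q₁ Q₂ →
    StrongOn V₂ (inducedArcs A V₂ ++ C) ×
    (¬ TwoArcStrongOn V₂ (inducedArcs A V₂ ++ C) →
     ∀ (x y : Fin n) (e : Fin (length (inducedArcs A V₂ ++ C))) →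
     lookup (inducedArcs A V₂ ++ C) e ≡ (x , y) →
     IsCutArc V₂ (inducedArcs A V₂ ++ C) e →
     ¬ ((x , y) ∈ C) ×
     ((((∀ v → InComp V₂ comp v (fromℕ (suc q)) ⇔ (v ≡ y)) ×
        (∀ v → InComp V₂ comp v (inject₁ (fromℕ q)) ⇔ (v ≡ x)) ×
        outdeg (inducedArcs A V₂ ++ C) x ≡ 1)
      ⊎ ((∀ v → InComp V₂ comp v zero ⇔ (v ≡ x)) ×
         (∀ v → InComp V₂ comp v (suc zero) ⇔ (v ≡ y)) ×
         indeg (inducedArcs A V₂ ++ C) y ≡ 1))
      ⊎ ((InComp V₂ comp x (fromℕ (suc q)) × InComp V₂ comp y (fromℕ (suc q)) × A x y ≡ true)
      ⊎ (InComp V₂ comp x zero × InComp V₂ comp y zero × A x y ≡ true))))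
lemma3p4 n A V₂ SD _ q comp AO C C-ok Q₁ Q₂ Q₁-ok Q₂-ok disj =
  H-strong , λ _ x y e e↦xy cut → let open CutArc e↦xy cut in cut-arc-∉C , classification
  where
  open TwoPathCompletion SD AO C C-ok Q₁ Q₂ Q₁-ok Q₂-ok disj
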